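{- Let $\mathbf{s}=(s_1,\dots,s_n)$ be a sequence of positive integers. The map $g_{\mathbf{s}}:\operatorname{KR}_{\mathbf{s}}\to\Psi_n$, $(\mathbf{k},\mathbf{r})\mapsto\mathbf{r}$, is a bijection.
   Context: $\langle N\rangle=\{0,\dots,N\}$, $\Psi_n=\langle s_1-1\rangle\times\cdots\times\langle s_n-1\rangle$. $\operatorname{Par}_{\mathbf{s}}=\{\sum_{j=1}^n c_j\mathbf{w}_j: 0\le c_j<1\}$ with $\mathbf{w}_j=(0,\dots,0,s_j,\dots,s_n)$ ($j-1$ leading zeros). For $\mathbf{x}\in\operatorname{Par}_{\mathbf{s}}\cap\mathbb{Z}^n$ let $k_i=\lfloor x_i/s_i\rfloor$ and $r_i=x_i-k_is_i\in\langle s_i-1\rangle$, and $f_{\mathbf{s}}(\mathbf{x})=(\mathbf{k},\mathbf{r})$ with $\mathbf{k}=(k_1,\dots,k_n)$, $\mathbf{r}=(r_1,\dots,r_n)$. $\operatorname{KR}_{\mathbf{s}}$ is the image $f_{\mathbf{s}}(\operatorname{Par}_{\mathbf{s}}\cap\mathbb{Z}^n)$. -}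

module Defs where

open import Data.Nat as ℕ using (ℕ; zero; suc)
open import Data.Nat.Base using (>-nonZero)
open import Data.Integer as ℤ using (ℤ; +_)
open import Data.Rational as ℚ using (ℚ)
open import Data.Fin using (Fin; zero; suc; _≤?_)
open import Data.Product using (Σ; ∃; _×_; _,_)
open import Relation.Nullary.Decidable using (⌊_⌋)
open import Data.Bool using (if_then_else_)
open import Relation.Binary.PropositionalEquality using (_≡_)

sumℚ : ∀ {n} → (Fin n → ℚ) → ℚ
sumℚ {zero}  f = ℚ.0ℚ
sumℚ {suc n} f = f zero ℚ.+ sumℚ (λ i → f (suc i))

-- A sequence s = (s_1,...,s_n) of natural numbers, given as Fin n → ℕ.
-- The generating vectors w_j = (0,...,0,s_j,...,s_n): coordinate i is s_i if j ≤ i, else 0.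
w : ∀ {n} → (Fin n → ℕ) → Fin n → Fin n → ℤ
w s j i = if ⌊ j ≤? i ⌋ then + (s i) else + 0

-- ⟨N⟩ = {0,...,N} ⊆ ℤ, so x ∈ ⟨s_i - 1⟩ iff 0 ≤ x ≤ s_i - 1, i.e. 0 ≤ x < s_i.
-- Integer points of the half-open parallelepiped Par_s (coefficients c_j in [0,1)).
-- Coefficients are taken in ℚ (for integer points they are necessarily rational).
InPar : ∀ {n} → (Fin n → ℕ) → (Fin n → ℤ) → Set
InPar {n} s x =
  Σ (Fin n → ℚ) λ c →
    (∀ j → (ℚ.0ℚ ℚ.≤ c j) × (c j ℚ.< ℚ.1ℚ)) ×
    (∀ i → (x i ℚ./ 1) ≡ sumℚ (λ j → c j ℚ.* (w s j i ℚ./ 1)))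

InΨ : ∀ {n} → (Fin n → ℕ) → (Fin n → ℤ) → Set
InΨ s r = ∀ i → (+ 0 ℤ.≤ r i) × (r i ℤ.≤ + (s i) ℤ.- + 1)

module _ {n : ℕ} (s : Fin n → ℕ) (pos : ∀ i → 0 ℕ.< s i) where

  kOf : (Fin n → ℤ) → Fin n → ℤ
  kOf x i = ℚ.floor (ℚ._/_ (x i) (s i) {{>-nonZero (pos i)}})

  rOf : (Fin n → ℤ) → Fin n → ℤ
  rOf x i = x i ℤ.- kOf x i ℤ.* + (s i)

  -- (k , r) ∈ KR_s = f_s(Par_s ∩ ℤ^n), with f_s(x) = (k(x), r(x));
  -- equality of tuples is componentwise.
  InKR : (Fin n → ℤ) → (Fin n → ℤ) → Set
  InKR k r = Σ (Fin n → ℤ) λ x → InPar s x × (∀ i → kOf x i ≡ k i) × (∀ i → rOf x i ≡ r i)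

module Submission where

open import Defs
open import Data.Nat using (ℕ; _<_)
open import Data.Integer using (ℤ)
open import Data.Fin using (Fin)
open import Data.Product using (Σ; _×_)
open import Relation.Binary.PropositionalEquality using (_≡_)

open import Data.Nat as ℕ using (zero; suc)
open import Data.Nat.Base using (>-nonZero)
open import Data.Integer as ℤ using (+_)
import Data.Integer.Properties as ℤP
import Data.Integer.DivMod as ℤD
open import Data.Integer.GCD using (gcd-zeroʳ)
open import Data.Rational as ℚ using (ℚ; mkℚ; 0ℚ; 1ℚ; _+_; _-_; _*_; -_)
import Data.Rational.Properties as ℚP
open import Data.Rational.Unnormalised as ℚᵘ using (mkℚᵘ)
import Data.Rational.Unnormalised.Properties as ℚᵘP
open import Data.Fin using (zero; suc; _≤?_)
open import Data.Bool using (Bool; true; false; if_then_else_)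
open import Data.Product using (_,_)
open import Function using (_∘_)
open import Relation.Nullary using (yes; no; contradiction)
open import Relation.Nullary.Decidable using (⌊_⌋)
open import Relation.Binary.PropositionalEquality
  using (refl; sym; trans; cong; cong₂; subst; subst₂; module ≡-Reasoning)
open import Data.Rational.Solver using (module +-*-Solver)
open +-*-Solver
import Data.Integer.Solver as ℤSolver
module ℤS = ℤSolver.+-*-Solver

-- A point x = Σ_j c_j w_j of Par_s has coordinates
-- x_i = s_i · P_i, where P_i = c_1 + ⋯ + c_i is the i-th prefix sum of the
-- coefficients c ∈ [0,1)^n.  Hence k_i = ⌊P_i⌋ and r_i = s_i · frac(P_i).
--   * Well-definedness: frac(P_i) ∈ [0,1), so r_i ∈ {0,…,s_i − 1}.
--   * Injectivity: r determines every frac(P_i), i.e. every P_i modulo 1.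
--     Since c_1 = P_1 and c_{i+1} = P_{i+1} − P_i with all c_j ∈ [0,1), the
--     prefix sums modulo 1 determine c; so c, hence P and k = ⌊P⌋, are fixed.
--   * Surjectivity: given r, put a_i = r_i / s_i ∈ [0,1) and
--     c_i = frac(a_i − a_{i−1}) (a_0 = 0); the sums telescope to P_i ≡ a_i
--     modulo 1, so x_i = ⌊P_i⌋ s_i + r_i is a point of Par_s with remainder r.
-- The file develops, in order: the embedding ι : ℤ → ℚ; floor, fractional
-- part and congruence modulo 1; scaling by a positive integer; prefix sums
-- and their reconstruction; finally the three parts of the theorem.

ι : ℤ → ℚ
ι i = i ℚ./ 1

-- ι as an unnormalised rational: every algebraic property is transported
-- through this description.
ι-ℚᵘ : ∀ i → ℚ.toℚᵘ (ι i) ℚᵘ.≃ mkℚᵘ i 0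
ι-ℚᵘ i = ℚP.toℚᵘ-fromℚᵘ (mkℚᵘ i 0)

ι-+ : ∀ a b → ι (a ℤ.+ b) ≡ ι a + ι b
ι-+ a b = ℚP.toℚᵘ-injective (begin
    ℚ.toℚᵘ (ι (a ℤ.+ b))              ≈⟨ ι-ℚᵘ (a ℤ.+ b) ⟩
    mkℚᵘ (a ℤ.+ b) 0                   ≈⟨ ℚᵘ.*≡* (cong (ℤ._* + 1) (sym (cong₂ ℤ._+_ (ℤP.*-identityʳ a) (ℤP.*-identityʳ b)))) ⟩
    mkℚᵘ a 0 ℚᵘ.+ mkℚᵘ b 0             ≈⟨ ℚᵘP.+-cong (ℚᵘP.≃-sym (ι-ℚᵘ a)) (ℚᵘP.≃-sym (ι-ℚᵘ b)) ⟩
    ℚ.toℚᵘ (ι a) ℚᵘ.+ ℚ.toℚᵘ (ι b)     ≈⟨ ℚᵘP.≃-sym (ℚP.toℚᵘ-homo-+ (ι a) (ι b)) ⟩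
    ℚ.toℚᵘ (ι a + ι b)                 ∎)
  where open ℚᵘP.≃-Reasoning

ι-* : ∀ a b → ι (a ℤ.* b) ≡ ι a * ι b
ι-* a b = ℚP.toℚᵘ-injective (begin
    ℚ.toℚᵘ (ι (a ℤ.* b))              ≈⟨ ι-ℚᵘ (a ℤ.* b) ⟩
    mkℚᵘ (a ℤ.* b) 0                   ≈⟨ ℚᵘ.*≡* refl ⟩
    mkℚᵘ a 0 ℚᵘ.* mkℚᵘ b 0             ≈⟨ ℚᵘP.*-cong (ℚᵘP.≃-sym (ι-ℚᵘ a)) (ℚᵘP.≃-sym (ι-ℚᵘ b)) ⟩
    ℚ.toℚᵘ (ι a) ℚᵘ.* ℚ.toℚᵘ (ι b)     ≈⟨ ℚᵘP.≃-sym (ℚP.toℚᵘ-homo-* (ι a) (ι b)) ⟩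
    ℚ.toℚᵘ (ι a * ι b)                 ∎)
  where open ℚᵘP.≃-Reasoning

ι-neg : ∀ a → ι (ℤ.- a) ≡ - ι a
ι-neg a = ℚP.toℚᵘ-injective (begin
    ℚ.toℚᵘ (ι (ℤ.- a))      ≈⟨ ι-ℚᵘ (ℤ.- a) ⟩
    ℚᵘ.- mkℚᵘ a 0           ≈⟨ ℚᵘP.-‿cong (ℚᵘP.≃-sym (ι-ℚᵘ a)) ⟩
    ℚᵘ.- ℚ.toℚᵘ (ι a)       ≈⟨ ℚᵘP.≃-sym (ℚP.toℚᵘ-homo‿- (ι a)) ⟩
    ℚ.toℚᵘ (- ι a)          ∎)
  where open ℚᵘP.≃-Reasoning

ι-- : ∀ a b → ι (a ℤ.- b) ≡ ι a - ι b
ι-- a b = trans (ι-+ a (ℤ.- b)) (cong (λ q → ι a + q) (ι-neg b))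

-- ι a has numerator a and denominator 1, so comparing ι a with ι b by
-- cross-multiplication compares a with b.
↥ι : ∀ i → ℚ.↥ (ι i) ≡ i
↥ι i = trans (sym (ℤP.*-identityʳ _)) (trans (cong (ℚ.↥ (ι i) ℤ.*_) (sym (gcd-zeroʳ i))) (ℚP.↥-/ i 1))

↧ι : ∀ i → ℚ.↧ (ι i) ≡ + 1
↧ι i = trans (sym (ℤP.*-identityʳ _)) (trans (cong (ℚ.↧ (ι i) ℤ.*_) (sym (gcd-zeroʳ i))) (ℚP.↧-/ i 1))

ι-cross : ∀ a b → ℚ.↥ (ι a) ℤ.* ℚ.↧ (ι b) ≡ a
ι-cross a b = trans (cong₂ ℤ._*_ (↥ι a) (↧ι b)) (ℤP.*-identityʳ a)

ι-mono-≤ : ∀ {a b} → a ℤ.≤ b → ι a ℚ.≤ ι b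
ι-mono-≤ {a} {b} a≤b = ℚ.*≤* (subst₂ ℤ._≤_ (sym (ι-cross a b)) (sym (ι-cross b a)) a≤b)

ι-mono-< : ∀ {a b} → a ℤ.< b → ι a ℚ.< ι b
ι-mono-< {a} {b} a<b = ℚ.*<* (subst₂ ℤ._<_ (sym (ι-cross a b)) (sym (ι-cross b a)) a<b)

ι-cancel-≤ : ∀ {a b} → ι a ℚ.≤ ι b → a ℤ.≤ b
ι-cancel-≤ {a} {b} (ℚ.*≤* le) = subst₂ ℤ._≤_ (ι-cross a b) (ι-cross b a) le

ι-cancel-< : ∀ {a b} → ι a ℚ.< ι b → a ℤ.< b
ι-cancel-< {a} {b} (ℚ.*<* lt) = subst₂ ℤ._<_ (ι-cross a b) (ι-cross b a) lt

<1+⇒≤ : ∀ {a b} → a ℤ.< b ℤ.+ + 1 → a ℤ.≤ b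
<1+⇒≤ {a} {b} lt = subst (a ℤ.≤_) (ℤS.solve 1 (λ b → ℤS.con (ℤ.- + 1) ℤS.:+ (b ℤS.:+ ℤS.con (+ 1)) ℤS.:= b) refl b)
                                  (ℤP.i<j⇒i≤pred[j] lt)

Unit : ℚ → Set
Unit a = (0ℚ ℚ.≤ a) × (a ℚ.< 1ℚ)

-- ⌊q⌋ ≤ q < ⌊q⌋ + 1: the defining bounds of the library's floor, read off
-- from Euclidean division of numerator by denominator.
floor-≤ : ∀ q → ι (ℚ.floor q) ℚ.≤ q
floor-≤ q@(mkℚ n d _) = ℚ.*≤* (subst₂ ℤ._≤_ (cong (ℤ._* D) (sym (↥ι f))) n≡ (ℤP.i≤j+i (f ℤ.* D) (+ (n ℤD.% D))))
  where
  D = + suc d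
  f = n ℤD./ D
  n≡ : + (n ℤD.% D) ℤ.+ f ℤ.* D ≡ n ℤ.* ℚ.↧ (ι f)
  n≡ = trans (sym (ℤD.a≡a%n+[a/n]*n n D)) (trans (sym (ℤP.*-identityʳ n)) (cong (n ℤ.*_) (sym (↧ι f))))

<floor+1 : ∀ q → q ℚ.< ι (ℚ.floor q ℤ.+ + 1)
<floor+1 q@(mkℚ n d _) = ℚ.*<* (subst₂ ℤ._<_ n≡ D+≡ (ℤP.+-monoˡ-< (f ℤ.* D) (ℤ.+<+ (ℤD.n%d<d n D))))
  where
  D = + suc d
  f = n ℤD./ D
  n≡ : + (n ℤD.% D) ℤ.+ f ℤ.* D ≡ n ℤ.* ℚ.↧ (ι (f ℤ.+ + 1))
  n≡ = trans (sym (ℤD.a≡a%n+[a/n]*n n D)) (trans (sym (ℤP.*-identityʳ n)) (cong (n ℤ.*_) (sym (↧ι (f ℤ.+ + 1)))))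
  D+≡ : D ℤ.+ f ℤ.* D ≡ ℚ.↥ (ι (f ℤ.+ + 1)) ℤ.* D
  D+≡ = trans (ℤS.solve 2 (λ f D → D ℤS.:+ f ℤS.:* D ℤS.:= (f ℤS.:+ ℤS.con (+ 1)) ℤS.:* D) refl f D)
              (cong (ℤ._* D) (sym (↥ι (f ℤ.+ + 1))))

-- The fractional part q − ⌊q⌋ (for negative q this differs from the
-- library's fracPart, which is taken relative to truncation).
frac : ℚ → ℚ
frac q = q - ι (ℚ.floor q)

frac-unit : ∀ q → Unit (frac q)
frac-unit q = subst (ℚ._≤ frac q) (ℚP.+-inverseʳ (ι f)) (ℚP.+-monoˡ-≤ (- ι f) (floor-≤ q))
            , subst (frac q ℚ.<_) f+1-f≡1 (ℚP.+-monoˡ-< (- ι f) (<floor+1 q))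
  where
  f = ℚ.floor q
  f+1-f≡1 : ι (f ℤ.+ + 1) - ι f ≡ 1ℚ
  f+1-f≡1 = trans (cong (_- ι f) (ι-+ f (+ 1))) (solve 1 (λ x → x :+ con 1ℚ :- x := con 1ℚ) refl (ι f))

frac-decomposition : ∀ q → q ≡ ι (ℚ.floor q) + frac q
frac-decomposition q = solve 2 (λ q f → q := f :+ (q :- f)) refl q (ι (ℚ.floor q))

+-cancelˡ : ∀ c {a b} → c + a ≡ c + b → a ≡ b
+-cancelˡ c {a} {b} e = begin
  a               ≡⟨ solve 2 (λ c a → a := :- c :+ (c :+ a)) refl c a ⟩
  - c + (c + a)   ≡⟨ cong (λ q → - c + q) e ⟩
  - c + (c + b)   ≡⟨ solve 2 (λ c b → :- c :+ (c :+ b) := b) refl c b ⟩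
  b               ∎
  where open ≡-Reasoning

_≈₁_ : ℚ → ℚ → Set
a ≈₁ b = Σ ℤ λ m → Σ ℤ λ n → ι m + a ≡ ι n + b

-- Shifting points of [0,1) by integers never makes them meet unless the
-- shifts agree: m + a = n + b forces m = n.  This is the source of all
-- uniqueness in the theorem.
integer-part-unique : ∀ {a b m n} → Unit a → Unit b → ι m + a ≡ ι n + b → m ≡ n
integer-part-unique (0≤a , a<1) (0≤b , b<1) e = ℤP.≤-antisym (part-≤ 0≤a b<1 e) (part-≤ 0≤b a<1 (sym e))
  where
  part-≤ : ∀ {a b m n} → 0ℚ ℚ.≤ a → b ℚ.< 1ℚ → ι m + a ≡ ι n + b → m ℤ.≤ n
  part-≤ {a} {b} {m} {n} 0≤a b<1 e = <1+⇒≤ (ι-cancel-< (begin-strict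
      ι m              ≡⟨ sym (ℚP.+-identityʳ (ι m)) ⟩
      ι m + 0ℚ         ≤⟨ ℚP.+-monoʳ-≤ (ι m) 0≤a ⟩
      ι m + a          ≡⟨ e ⟩
      ι n + b          <⟨ ℚP.+-monoʳ-< (ι n) b<1 ⟩
      ι n + 1ℚ         ≡⟨ sym (ι-+ n (+ 1)) ⟩
      ι (n ℤ.+ + 1)    ∎))
    where open ℚP.≤-Reasoning

≈₁-unit-equal : ∀ {a b} → Unit a → Unit b → a ≈₁ b → a ≡ b
≈₁-unit-equal {a} {b} ua ub (m , n , e) =
  +-cancelˡ (ι m) (trans e (cong (λ k → ι k + b) (sym (integer-part-unique {m = m} {n} ua ub e))))

≈₁-cancelˡ : ∀ c {a b} → (c + a) ≈₁ (c + b) → a ≈₁ b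
≈₁-cancelˡ c {a} {b} (m , n , e) = m , n , +-cancelˡ c (begin
  c + (ι m + a)    ≡⟨ solve 3 (λ c m a → c :+ (m :+ a) := m :+ (c :+ a)) refl c (ι m) a ⟩
  ι m + (c + a)    ≡⟨ e ⟩
  ι n + (c + b)    ≡⟨ solve 3 (λ c n b → n :+ (c :+ b) := c :+ (n :+ b)) refl c (ι n) b ⟩
  c + (ι n + b)    ∎)
  where open ≡-Reasoning

frac-≡⇒≈₁ : ∀ {q q′} → frac q ≡ frac q′ → q ≈₁ q′
frac-≡⇒≈₁ {q} {q′} e = ℚ.floor q′ , ℚ.floor q , (begin
  ι f′ + q                   ≡⟨ cong (_+_ (ι f′)) (frac-decomposition q) ⟩
  ι f′ + (ι f + frac q)      ≡⟨ cong (λ t → ι f′ + (ι f + t)) e ⟩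
  ι f′ + (ι f + frac q′)     ≡⟨ solve 3 (λ a b t → a :+ (b :+ t) := b :+ (a :+ t)) refl (ι f′) (ι f) (frac q′) ⟩
  ι f + (ι f′ + frac q′)     ≡⟨ cong (_+_ (ι f)) (sym (frac-decomposition q′)) ⟩
  ι f + q′                   ∎)
  where
  open ≡-Reasoning
  f = ℚ.floor q
  f′ = ℚ.floor q′

≈₁⇒frac-≡ : ∀ {q a} → q ≈₁ a → Unit a → frac q ≡ a
≈₁⇒frac-≡ {q} {a} (m , n , e) ua = ≈₁-unit-equal (frac-unit q) ua (m ℤ.+ ℚ.floor q , n , (begin
  ι (m ℤ.+ ℚ.floor q) + frac q     ≡⟨ cong (_+ frac q) (ι-+ m (ℚ.floor q)) ⟩
  ι m + ι (ℚ.floor q) + frac q     ≡⟨ ℚP.+-assoc (ι m) _ _ ⟩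
  ι m + (ι (ℚ.floor q) + frac q)   ≡⟨ cong (_+_ (ι m)) (sym (frac-decomposition q)) ⟩
  ι m + q                          ≡⟨ e ⟩
  ι n + a                          ∎))
  where open ≡-Reasoning

*-cancelʳ-pos : ∀ t .{{_ : ℚ.Positive t}} {u v} → u * t ≡ v * t → u ≡ v
*-cancelʳ-pos t e = ℚP.≤-antisym (ℚP.*-cancelʳ-≤-pos t (ℚP.≤-reflexive e)) (ℚP.*-cancelʳ-≤-pos t (ℚP.≤-reflexive (sym e)))

ι-positive : ∀ {s} → 0 < s → ℚ.Positive (ι (+ s))
ι-positive 0<s = ℚ.positive (ι-mono-< (ℤ.+<+ 0<s))

/-scaled : ∀ x s .{{_ : ℕ.NonZero s}} → (x ℚ./ s) * ι (+ s) ≡ ι x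
/-scaled x (suc m) = ℚP.toℚᵘ-injective (begin
    ℚ.toℚᵘ ((x ℚ./ suc m) * ι (+ suc m))                ≈⟨ ℚP.toℚᵘ-homo-* (x ℚ./ suc m) (ι (+ suc m)) ⟩
    ℚ.toℚᵘ (x ℚ./ suc m) ℚᵘ.* ℚ.toℚᵘ (ι (+ suc m))      ≈⟨ ℚᵘP.*-cong (ℚP.toℚᵘ-fromℚᵘ (mkℚᵘ x m)) (ι-ℚᵘ (+ suc m)) ⟩
    mkℚᵘ x m ℚᵘ.* mkℚᵘ (+ suc m) 0                      ≈⟨ ℚᵘ.*≡* (ℤS.solve 2 (λ x s →
                                                              (x ℤS.:* s) ℤS.:* ℤS.con (+ 1) ℤS.:= x ℤS.:* (s ℤS.:* ℤS.con (+ 1)))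
                                                              refl x (+ suc m)) ⟩
    mkℚᵘ x 0                                            ≈⟨ ℚᵘP.≃-sym (ι-ℚᵘ x) ⟩
    ℚ.toℚᵘ (ι x)                                        ∎)
  where open ℚᵘP.≃-Reasoning

Digit : ℕ → ℤ → Set
Digit s r = (+ 0 ℤ.≤ r) × (r ℤ.≤ + s ℤ.- + 1)

<⇒≤-1 : ∀ {a b} → a ℤ.< b → a ℤ.≤ b ℤ.- + 1
<⇒≤-1 {a} {b} lt = subst (a ℤ.≤_) (ℤP.+-comm (ℤ.- + 1) b) (ℤP.i<j⇒i≤pred[j] lt)

≤-1⇒< : ∀ {a b} → a ℤ.≤ b ℤ.- + 1 → a ℤ.< b
≤-1⇒< {a} {b} le = ℤP.i≤pred[j]⇒i<j (subst (a ℤ.≤_) (ℤP.+-comm b (ℤ.- + 1)) le)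

unit⇒digit : ∀ {s} → 0 < s → ∀ {u r} → u * ι (+ s) ≡ ι r → Unit u → Digit s r
unit⇒digit {s} 0<s {u} {r} us≡r (0≤u , u<1) =
    ι-cancel-≤ (subst₂ ℚ._≤_ (ℚP.*-zeroˡ S) us≡r (ℚP.*-monoʳ-≤-nonNeg S 0≤u))
  , <⇒≤-1 {r} {+ s} (ι-cancel-< (subst₂ ℚ._<_ us≡r (ℚP.*-identityˡ S) (ℚP.*-monoˡ-<-pos S u<1)))
  where
  S = ι (+ s)
  instance
    S-pos = ι-positive 0<s
    S-nonNeg = ℚP.pos⇒nonNeg S

digit⇒unit : ∀ {s} → 0 < s → ∀ {u r} → u * ι (+ s) ≡ ι r → Digit s r → Unit u
digit⇒unit {s} 0<s {u} {r} us≡r (0≤r , r≤s-1) =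
    ℚP.*-cancelʳ-≤-pos S (subst₂ ℚ._≤_ (sym (ℚP.*-zeroˡ S)) (sym us≡r) (ι-mono-≤ 0≤r))
  , ℚP.*-cancelʳ-<-nonNeg S (subst₂ ℚ._<_ (sym us≡r) (sym (ℚP.*-identityˡ S)) (ι-mono-< (≤-1⇒< {r} {+ s} r≤s-1)))
  where
  S = ι (+ s)
  instance
    S-pos = ι-positive 0<s
    S-nonNeg = ℚP.pos⇒nonNeg S

sumℚ-cong : ∀ {n} {f g : Fin n → ℚ} → (∀ j → f j ≡ g j) → sumℚ f ≡ sumℚ g
sumℚ-cong {zero} f≡g = refl
sumℚ-cong {suc n} f≡g = cong₂ _+_ (f≡g zero) (sumℚ-cong (f≡g ∘ suc))

sumℚ-zero : ∀ n → sumℚ {n} (λ _ → 0ℚ) ≡ 0ℚ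
sumℚ-zero zero = refl
sumℚ-zero (suc n) = trans (ℚP.+-identityˡ _) (sumℚ-zero n)

-- The i-th prefix sum P_i = Σ_{j ≤ i} c_j, written with the same selector
-- j ≤ i that defines the generators w_j.
prefix : ∀ {n} → (Fin n → ℚ) → Fin n → ℚ
prefix c i = sumℚ (λ j → if ⌊ j ≤? i ⌋ then c j else 0ℚ)

≤?-suc : ∀ {n} (j i : Fin n) → ⌊ suc j ≤? suc i ⌋ ≡ ⌊ j ≤? i ⌋
≤?-suc j i with suc j ≤? suc i | j ≤? i
... | yes _      | yes _   = refl
... | no _       | no _    = refl
... | yes sj≤si  | no j≰i  = contradiction (ℕ.s≤s⁻¹ sj≤si) j≰i
... | no sj≰si   | yes j≤i = contradiction (ℕ.s≤s j≤i) sj≰si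

prefix-zero : ∀ {n} (c : Fin (suc n) → ℚ) → prefix c zero ≡ c zero
prefix-zero {n} c = trans (cong (_+_ (c zero)) (sumℚ-zero n)) (ℚP.+-identityʳ (c zero))

prefix-suc : ∀ {n} (c : Fin (suc n) → ℚ) i → prefix c (suc i) ≡ c zero + prefix (c ∘ suc) i
prefix-suc c i = cong (_+_ (c zero)) (sumℚ-cong λ j → cong (λ b → if b then c (suc j) else 0ℚ) (≤?-suc j i))

prefix-cong : ∀ {n} {c c′ : Fin n → ℚ} → (∀ j → c j ≡ c′ j) → ∀ i → prefix c i ≡ prefix c′ i
prefix-cong c≡c′ i = sumℚ-cong λ j → cong (λ t → if ⌊ j ≤? i ⌋ then t else 0ℚ) (c≡c′ j)

sum-selection : ∀ {n} (c : Fin n → ℚ) (b : Fin n → Bool) t →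
  sumℚ (λ j → c j * ι (if b j then t else + 0)) ≡ ι t * sumℚ (λ j → if b j then c j else 0ℚ)
sum-selection {zero} c b t = sym (ℚP.*-zeroʳ (ι t))
sum-selection {suc n} c b t =
  trans (cong₂ _+_ (term (b zero)) (sum-selection (c ∘ suc) (b ∘ suc) t))
        (sym (ℚP.*-distribˡ-+ (ι t) _ _))
  where
  term : ∀ b₀ → c zero * ι (if b₀ then t else + 0) ≡ ι t * (if b₀ then c zero else 0ℚ)
  term true = ℚP.*-comm (c zero) (ι t)
  term false = trans (ℚP.*-zeroʳ (c zero)) (sym (ℚP.*-zeroʳ (ι t)))

combination-coordinate : ∀ {n} (s : Fin n → ℕ) (c : Fin n → ℚ) i →
  sumℚ (λ j → c j * ι (w s j i)) ≡ ι (+ s i) * prefix c i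
combination-coordinate s c i = sum-selection c (λ j → ⌊ j ≤? i ⌋) (+ s i)

-- Coefficients in [0,1) are determined by their prefix sums modulo 1:
-- c_1 = P_1, and c_{j+1} is recovered from P_{j+1} once c_1 is known.
prefix-determines : ∀ {n} (c c′ : Fin n → ℚ) → (∀ j → Unit (c j)) → (∀ j → Unit (c′ j)) →
  (∀ i → prefix c i ≈₁ prefix c′ i) → ∀ j → c j ≡ c′ j
prefix-determines c c′ u u′ P≈P′ zero =
  ≈₁-unit-equal (u zero) (u′ zero) (subst₂ _≈₁_ (prefix-zero c) (prefix-zero c′) (P≈P′ zero))
prefix-determines c c′ u u′ P≈P′ (suc j) =
  prefix-determines (c ∘ suc) (c′ ∘ suc) (u ∘ suc) (u′ ∘ suc) tail≈ j
  where
  head≡ : c zero ≡ c′ zero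
  head≡ = prefix-determines c c′ u u′ P≈P′ zero
  tail≈ : ∀ i → prefix (c ∘ suc) i ≈₁ prefix (c′ ∘ suc) i
  tail≈ i = ≈₁-cancelˡ (c zero)
    (subst₂ _≈₁_ (prefix-suc c i) (trans (prefix-suc c′ i) (cong (_+ prefix (c′ ∘ suc) i) (sym head≡))) (P≈P′ (suc i)))

-- Coefficients realising prescribed prefix sums modulo 1: with a_{-1} = p,
-- take the fractional parts of the successive differences a_j − a_{j−1}.
frac-steps : ∀ {n} → ℚ → (Fin n → ℚ) → Fin n → ℚ
frac-steps p a zero = frac (a zero - p)
frac-steps p a (suc j) = frac-steps (a zero) (a ∘ suc) j

frac-steps-unit : ∀ {n} p (a : Fin n → ℚ) j → Unit (frac-steps p a j)
frac-steps-unit p a zero = frac-unit (a zero - p)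
frac-steps-unit p a (suc j) = frac-steps-unit (a zero) (a ∘ suc) j

-- The differences telescope: p + P_i ≡ a_i modulo 1.
frac-steps-prefix : ∀ {n} p (a : Fin n → ℚ) i → (p + prefix (frac-steps p a) i) ≈₁ a i
frac-steps-prefix p a zero = ℚ.floor (a zero - p) , + 0 , (begin
  ι f + (p + prefix (frac-steps p a) zero)   ≡⟨ cong (λ t → ι f + (p + t)) (prefix-zero (frac-steps p a)) ⟩
  ι f + (p + ((a zero - p) - ι f))           ≡⟨ solve 3 (λ f p a → f :+ (p :+ ((a :- p) :- f)) := con 0ℚ :+ a) refl (ι f) p (a zero) ⟩
  0ℚ + a zero                                ∎)
  where
  open ≡-Reasoning
  f = ℚ.floor (a zero - p)
frac-steps-prefix p a (suc i) with frac-steps-prefix (a zero) (a ∘ suc) i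
... | m , n , e = f ℤ.+ m , n , (begin
  ι (f ℤ.+ m) + (p + prefix c (suc i))             ≡⟨ cong₂ (λ u v → u + (p + v)) (ι-+ f m) (prefix-suc c i) ⟩
  ι f + ι m + (p + (((a zero - p) - ι f) + Q))     ≡⟨ solve 5 (λ f m p a Q → f :+ m :+ (p :+ (((a :- p) :- f) :+ Q)) := m :+ (a :+ Q))
                                                        refl (ι f) (ι m) p (a zero) Q ⟩
  ι m + (a zero + Q)                               ≡⟨ e ⟩
  ι n + a (suc i)                                  ∎)
  where
  open ≡-Reasoning
  f = ℚ.floor (a zero - p)
  c = frac-steps p a
  Q = prefix (c ∘ suc) i

module _ {n : ℕ} (s : Fin n → ℕ) (pos : ∀ i → 0 < s i) where

  S : Fin n → ℚ
  S i = ι (+ s i)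

  instance
    S-positive : ∀ {i} → ℚ.Positive (S i)
    S-positive {i} = ι-positive (pos i)

  quotient : (Fin n → ℤ) → Fin n → ℚ
  quotient x i = ℚ._/_ (x i) (s i) {{>-nonZero (pos i)}}

  quotient-scaled : ∀ x i → quotient x i * S i ≡ ι (x i)
  quotient-scaled x i = /-scaled (x i) (s i) {{>-nonZero (pos i)}}

  remainder-frac : ∀ x i → ι (rOf s pos x i) ≡ frac (quotient x i) * S i
  remainder-frac x i = begin
    ι (x i ℤ.- k ℤ.* + s i)           ≡⟨ trans (ι-- (x i) _) (cong (λ t → ι (x i) - t) (ι-* k (+ s i))) ⟩
    ι (x i) - ι k * S i               ≡⟨ cong (λ t → t - ι k * S i) (sym (quotient-scaled x i)) ⟩
    quotient x i * S i - ι k * S i    ≡⟨ solve 3 (λ q k S → q :* S :- k :* S := (q :- k) :* S) refl (quotient x i) (ι k) (S i) ⟩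
    frac (quotient x i) * S i         ∎
    where
    open ≡-Reasoning
    k = kOf s pos x i

  Combination : (Fin n → ℚ) → (Fin n → ℤ) → Set
  Combination c x = ∀ i → ι (x i) ≡ sumℚ (λ j → c j * ι (w s j i))

  quotient-prefix : ∀ c x → Combination c x → ∀ i → quotient x i ≡ prefix c i
  quotient-prefix c x x≡Σ i = *-cancelʳ-pos (S i) (begin
    quotient x i * S i   ≡⟨ quotient-scaled x i ⟩
    ι (x i)              ≡⟨ x≡Σ i ⟩
    _                    ≡⟨ combination-coordinate s c i ⟩
    S i * prefix c i     ≡⟨ ℚP.*-comm (S i) (prefix c i) ⟩
    prefix c i * S i     ∎)
    where open ≡-Reasoning

  remainders-are-digits : (k r : Fin n → ℤ) → InKR s pos k r → InΨ s r
  remainders-are-digits k r (x , _ , _ , rx) i =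
    subst (Digit (s i)) (rx i) (unit⇒digit (pos i) (sym (remainder-frac x i)) (frac-unit (quotient x i)))

  -- g_s is injective: equal remainders force equal fractional parts of the
  -- prefix sums, hence equal coefficients, hence equal k = ⌊P⌋.
  remainders-determine : (k r k′ r′ : Fin n → ℤ) → InKR s pos k r → InKR s pos k′ r′ →
    (∀ i → r i ≡ r′ i) → (∀ i → k i ≡ k′ i)
  remainders-determine k r k′ r′ (x , (c , c-unit , x≡Σ) , kx , rx) (x′ , (c′ , c′-unit , x′≡Σ) , kx′ , rx′) r≡r′ i =
    begin
      k i                        ≡⟨ sym (kx i) ⟩
      ℚ.floor (quotient x i)     ≡⟨ cong ℚ.floor (quotient-prefix c x x≡Σ i) ⟩
      ℚ.floor (prefix c i)       ≡⟨ cong ℚ.floor (prefix-cong c≡c′ i) ⟩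
      ℚ.floor (prefix c′ i)      ≡⟨ cong ℚ.floor (sym (quotient-prefix c′ x′ x′≡Σ i)) ⟩
      ℚ.floor (quotient x′ i)    ≡⟨ kx′ i ⟩
      k′ i                       ∎
    where
    open ≡-Reasoning
    frac≡ : ∀ i → frac (prefix c i) ≡ frac (prefix c′ i)
    frac≡ i = *-cancelʳ-pos (S i) (begin
      frac (prefix c i) * S i       ≡⟨ cong (λ q → frac q * S i) (sym (quotient-prefix c x x≡Σ i)) ⟩
      frac (quotient x i) * S i     ≡⟨ sym (remainder-frac x i) ⟩
      ι (rOf s pos x i)             ≡⟨ cong ι (trans (rx i) (trans (r≡r′ i) (sym (rx′ i)))) ⟩
      ι (rOf s pos x′ i)            ≡⟨ remainder-frac x′ i ⟩
      frac (quotient x′ i) * S i    ≡⟨ cong (λ q → frac q * S i) (quotient-prefix c′ x′ x′≡Σ i) ⟩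
      frac (prefix c′ i) * S i      ∎)
    c≡c′ : ∀ j → c j ≡ c′ j
    c≡c′ = prefix-determines c c′ c-unit c′-unit (λ i → frac-≡⇒≈₁ (frac≡ i))

  -- g_s is surjective: with a_i = r_i / s_i and c the fractional steps of a,
  -- the point x_i = ⌊P_i⌋ s_i + r_i lies in Par_s and has remainder r.
  digits-realised : (r : Fin n → ℤ) → InΨ s r → Σ (Fin n → ℤ) λ k → InKR s pos k r
  digits-realised r r-digit = kOf s pos x , x , (c , frac-steps-unit 0ℚ a , x≡Σ) , (λ _ → refl) , rx
    where
    open ≡-Reasoning
    a : Fin n → ℚ
    a = quotient r
    c : Fin n → ℚ
    c = frac-steps 0ℚ a
    frac-prefix : ∀ i → frac (prefix c i) ≡ a i
    frac-prefix i = ≈₁⇒frac-≡ (subst (_≈₁ a i) (ℚP.+-identityˡ (prefix c i)) (frac-steps-prefix 0ℚ a i))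
                              (digit⇒unit (pos i) (quotient-scaled r i) (r-digit i))
    x : Fin n → ℤ
    x i = ℚ.floor (prefix c i) ℤ.* + s i ℤ.+ r i
    x≡Σ : Combination c x
    x≡Σ i = begin
      ι (x i)                                      ≡⟨ ι-+ (f ℤ.* + s i) (r i) ⟩
      ι (f ℤ.* + s i) + ι (r i)                    ≡⟨ cong₂ _+_ (ι-* f (+ s i)) (sym (quotient-scaled r i)) ⟩
      ι f * S i + a i * S i                        ≡⟨ cong (λ t → ι f * S i + t * S i) (sym (frac-prefix i)) ⟩
      ι f * S i + frac (prefix c i) * S i          ≡⟨ sym (ℚP.*-distribʳ-+ (S i) (ι f) _) ⟩
      (ι f + frac (prefix c i)) * S i              ≡⟨ cong (_* S i) (sym (frac-decomposition (prefix c i))) ⟩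
      prefix c i * S i                             ≡⟨ ℚP.*-comm (prefix c i) (S i) ⟩
      S i * prefix c i                             ≡⟨ sym (combination-coordinate s c i) ⟩
      sumℚ (λ j → c j * ι (w s j i))               ∎
      where f = ℚ.floor (prefix c i)
    rx : ∀ i → rOf s pos x i ≡ r i
    rx i = begin
      x i ℤ.- kOf s pos x i ℤ.* + s i   ≡⟨ cong (λ q → x i ℤ.- ℚ.floor q ℤ.* + s i) (quotient-prefix c x x≡Σ i) ⟩
      x i ℤ.- f ℤ.* + s i               ≡⟨ ℤS.solve 2 (λ fs r → (fs ℤS.:+ r) ℤS.:- fs ℤS.:= r) refl (f ℤ.* + s i) (r i) ⟩
      r i                               ∎
      where f = ℚ.floor (prefix c i)

lemma3p3 : (n : ℕ) (s : Fin n → ℕ) (pos : ∀ i → 0 < s i) →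
    ((k r : Fin n → ℤ) → InKR s pos k r → InΨ s r) ×
    ((k r k′ r′ : Fin n → ℤ) → InKR s pos k r → InKR s pos k′ r′ →
      (∀ i → r i ≡ r′ i) → (∀ i → k i ≡ k′ i)) ×
    ((r : Fin n → ℤ) → InΨ s r → Σ (Fin n → ℤ) λ k → InKR s pos k r)
lemma3p3 n s pos = remainders-are-digits s pos , remainders-determine s pos , digits-realised s pos
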